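{- Let $G$ be a finite nontrivial connected graph. If an irredundant broadcast $f$ on $G$ is dominating, then $f$ is both maximal irredundant and a minimal dominating broadcast.
   Context: A broadcast on $G=(V,E)$ is a function $f:V\to\{0,1,\dots,\operatorname{diam}(G)\}$ with $f(v)\le e(v)$ (the eccentricity of $v$) for all $v$. Let $V_f^+=\{v:f(v)>0\}$. A vertex $u$ is dominated by $f$ if $d(u,v)\le f(v)$ for some $v\in V_f^+$. The broadcast $f$ is dominating if every vertex is dominated. Write $g\le f$ if $g(v)\le f(v)$ for all $v$, and $g<f$ if moreover strict inequality holds for some $v$; write $g>f$ if $f<g$. A dominating broadcast $f$ is minimal dominating if no broadcast $g<f$ is dominating. For $v\in V_f^+$, let $N_f[v]=\{u:d(u,v)\le f(v)\}$. The $f$-private boundary $\operatorname{PB}_f(v)$ is the set of $u\in N_f[v]$ not dominated by the broadcast obtained from $f$ by replacing $f(v)$ with $f(v)-1$, other values unchanged. The broadcast $f$ is irredundant if $\operatorname{PB}_f(v)\ne\varnothing$ for all $v\in V_f^+$. An irredundant $f$ is maximal irredundant if no broadcast $g>f$ is irredundant. -}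

module Defs where

open import Data.Nat using (ℕ; zero; suc; _≤_; _<_; _∸_)
open import Data.Fin using (Fin; _≟_)
open import Data.Product using (Σ; ∃; _×_; _,_)
open import Relation.Nullary using (¬_; yes; no)
open import Relation.Binary.PropositionalEquality using (_≡_)
open import Level using (0ℓ) renaming (suc to lsuc)

record Graph (n : ℕ) : Set₁ where
  field
    Adj     : Fin n → Fin n → Set
    sym     : ∀ {u v} → Adj u v → Adj v u
    irrefl  : ∀ {u} → ¬ Adj u u
open Graph public

module _ {n : ℕ} (G : Graph n) where

  data Walk : Fin n → Fin n → ℕ → Set where
    here  : ∀ {u} → Walk u u zero
    step  : ∀ {u w v k} → Adj G u w → Walk w v k → Walk u v (suc k)

  Connected : Set
  Connected = ∀ u v → ∃ λ k → Walk u v k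

  IsDist : Fin n → Fin n → ℕ → Set
  IsDist u v d = Walk u v d × (∀ m → Walk u v m → d ≤ m)

  IsEcc : Fin n → ℕ → Set
  IsEcc v e = (∀ u d → IsDist u v d → d ≤ e) × (∃ λ u → IsDist u v e)

  DistLe : Fin n → Fin n → ℕ → Set
  DistLe u v k = ∃ λ d → IsDist u v d × d ≤ k

  -- broadcast: f(v) ≤ e(v) for all v (hence also f(v) ≤ diam G)
  IsBroadcast : (Fin n → ℕ) → Set
  IsBroadcast f = ∀ v e → IsEcc v e → f v ≤ e

  Dominated : (Fin n → ℕ) → Fin n → Set
  Dominated f u = ∃ λ v → 0 < f v × DistLe u v (f v)

  Dominating : (Fin n → ℕ) → Set
  Dominating f = ∀ u → Dominated f u

  _≤B_ : (Fin n → ℕ) → (Fin n → ℕ) → Set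
  g ≤B f = ∀ v → g v ≤ f v

  _<B_ : (Fin n → ℕ) → (Fin n → ℕ) → Set
  g <B f = g ≤B f × ∃ λ v → g v < f v

  MinimalDominating : (Fin n → ℕ) → Set
  MinimalDominating f =
    Dominating f × (∀ g → IsBroadcast g → g <B f → ¬ Dominating g)

  decAt : (Fin n → ℕ) → Fin n → Fin n → ℕ
  decAt f v w with w ≟ v
  ... | yes _ = f v ∸ 1
  ... | no _  = f w

  InPB : (Fin n → ℕ) → Fin n → Fin n → Set
  InPB f v u = DistLe u v (f v) × ¬ Dominated (decAt f v) u

  Irredundant : (Fin n → ℕ) → Set
  Irredundant f = ∀ v → 0 < f v → ∃ λ u → InPB f v u

  MaximalIrredundant : (Fin n → ℕ) → Set
  MaximalIrredundant f =
    Irredundant f × (∀ g → IsBroadcast g → f <B g → ¬ Irredundant g)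

module Submission where

-- If a dominating h lay strictly below an irredundant k, say h v < k v, then h would still lie
-- below k with k(v) lowered by one; that broadcast would then dominate everything, including
-- the nonempty private boundary of v under k, which by definition it does not dominate.
-- Applied with (h , k) = (f , g) and (g , f) this gives both halves of the theorem.

open import Defs
open import Data.Nat using (ℕ; _≤_; _<_; z≤n; s≤s)
open import Data.Nat.Properties using (≤-trans; <-≤-trans; ∸-monoˡ-≤)
open import Data.Product using (_×_; _,_)
open import Data.Fin using (Fin; _≟_)
open import Relation.Nullary using (¬_; yes; no)
open import Relation.Binary.PropositionalEquality using (refl)

module _ {n : ℕ} (G : Graph n) where

  Dominated-mono : ∀ {h k} → _≤B_ G h k → ∀ {u} → Dominated G h u → Dominated G k u
  Dominated-mono h≤k (w , 0<hw , d , isDist , d≤hw) =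
    w , <-≤-trans 0<hw (h≤k w) , d , isDist , ≤-trans d≤hw (h≤k w)

  ≤B-decAt : ∀ {h k v} → _≤B_ G h k → h v < k v → _≤B_ G h (decAt G k v)
  ≤B-decAt {v = v} h≤k hv<kv w with w ≟ v
  ... | yes refl = ∸-monoˡ-≤ 1 hv<kv
  ... | no _     = h≤k w

  dominating-not-below-irredundant : ∀ {h k} → Dominating G h → Irredundant G k →
                                     ¬ (_<B_ G h k)
  dominating-not-below-irredundant dom irr (h≤k , v , hv<kv)
    with irr v (≤-trans (s≤s z≤n) hv<kv)
  ... | u , _ , undominated = undominated (Dominated-mono (≤B-decAt h≤k hv<kv) (dom u))

corollary4 : (n : ℕ) → (G : Graph n) → 2 ≤ n → Connected G →
    (f : Fin n → ℕ) → IsBroadcast G f → Irredundant G f → Dominating G f →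
    MaximalIrredundant G f × MinimalDominating G f
corollary4 n G _ _ f _ irr dom =
  (irr , λ g _ f<g irrg → dominating-not-below-irredundant G dom irrg f<g) ,
  (dom , λ g _ g<f domg → dominating-not-below-irredundant G domg irr g<f)
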